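{- Let $r\ge 1$, let $X=[r]=\{1,\dots,r\}$ and let $U\subseteq X\times X$ be any relation. Then the following are equivalent: (a) for every rearrangement class $R(\mathbf c)$ and every integer $k$, the number of words $w\in R(\mathbf c)$ with $\mathrm{maj}'_U w=k$ equals the number of words $w\in R(\mathbf c)$ with $\mathrm{inv}'_U w=k$; (b) $U$ is bipartitional.
   Context: Words are finite sequences $w=x_1x_2\cdots x_m$ of letters of $X$. For $\mathbf c=(c(1),\dots,c(r))$ a sequence of non-negative integers, $R(\mathbf c)$ is the set of all words containing exactly $c(i)$ occurrences of the letter $i$ for each $i$. For $w=x_1\cdots x_m$ define $\mathrm{maj}'_U w=\sum_{i=1}^{m-1} i\,\chi((x_i,x_{i+1})\in U)$ and $\mathrm{inv}'_U w=\sum_{1\le i<j\le m}\chi((x_i,x_j)\in U)$, where $\chi(A)=1$ if $A$ is true and $0$ otherwise. An ordered bipartition of $X$ is a sequence $(B_1,\dots,B_k)$ of non-empty pairwise disjoint subsets of $X$ with union $X$, together with a sequence $(\beta_1,\dots,\beta_k)\in\{0,1\}^k$; $B_l$ is called underlined if $\beta_l=1$. A relation $U$ is bipartitional if there is an ordered bipartition such that $(x,y)\in U$ iff either $x\in B_l$, $y\in B_{l'}$ with $l<l'$, or $x,y$ lie in the same block $B_l$ and $\beta_l=1$. -}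

module Defs where

open import Data.Nat using (ℕ; zero; suc; _+_; _*_; _<_)
open import Data.Bool using (Bool; true; false; if_then_else_)
open import Data.Fin using (Fin; _≟_) renaming (_<_ to _<ᶠ_)
open import Data.List using (List; []; _∷_; length; filter; map; concatMap; allFin; [_])
open import Data.Product using (Σ; ∃; _×_)
open import Data.Sum using (_⊎_)
open import Relation.Nullary.Decidable using (_×-dec_)
open import Data.Fin.Properties using (all?)
import Data.Bool as B
open import Relation.Binary.PropositionalEquality using (_≡_)
open import Function.Bundles using (_⇔_)
import Data.Nat as ℕ
import Data.Fin as Fin

Relation : ℕ → Set
Relation r = Fin r → Fin r → Bool

χ : Bool → ℕ
χ true  = 1
χ false = 0

-- maj'_U with positions counted from i (the paper uses i = 1 for the first letter)
majFrom : ∀ {r} → Relation r → ℕ → List (Fin r) → ℕ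
majFrom U i []             = 0
majFrom U i (x ∷ [])       = 0
majFrom U i (x ∷ y ∷ rest) = i * χ (U x y) + majFrom U (suc i) (y ∷ rest)

maj′ : ∀ {r} → Relation r → List (Fin r) → ℕ
maj′ U w = majFrom U 1 w

inv′ : ∀ {r} → Relation r → List (Fin r) → ℕ
inv′ U []       = 0
inv′ U (x ∷ xs) = length (filter (λ y → U x y B.≟ true) xs) + inv′ U xs

occ : ∀ {r} → Fin r → List (Fin r) → ℕ
occ i w = length (filter (_≟ i) w)

allWords : (r n : ℕ) → List (List (Fin r))
allWords r zero    = [ [] ]
allWords r (suc n) = concatMap (λ w → map (_∷ w) (allFin r)) (allWords r n)

total : ∀ {r} → (Fin r → ℕ) → ℕ
total {zero}  c = 0
total {suc r} c = c Fin.zero + total (λ i → c (Fin.suc i))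

countStat : ∀ {r} → (List (Fin r) → ℕ) → (Fin r → ℕ) → ℕ → ℕ
countStat {r} stat c k =
  length (filter (λ w → all? (λ i → occ i w ℕ.≟ c i) ×-dec (stat w ℕ.≟ k))
                 (allWords r (total c)))

Equidistributed : ∀ {r} → Relation r → Set
Equidistributed {r} U =
  ∀ (c : Fin r → ℕ) (k : ℕ) → countStat (maj′ U) c k ≡ countStat (inv′ U) c k

-- An ordered bipartition (B_1,…,B_m) of X
-- is encoded by the block-assignment map f : X → Fin m (x ∈ B_{f x}), which
-- is surjective (blocks non-empty), with underlining flags β : Fin m → Bool.
Bipartitional : ∀ {r} → Relation r → Set
Bipartitional {r} U =
  Σ ℕ λ m → Σ (Fin r → Fin m) λ f → Σ (Fin m → Bool) λ β →
    (∀ (l : Fin m) → ∃ λ x → f x ≡ l) ×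
    (∀ (x y : Fin r) →
       (U x y ≡ true) ⇔ ((f x <ᶠ f y) ⊎ (f x ≡ f y × β (f x) ≡ true)))

{-# OPTIONS --safe #-}
-- (b ⇒ a) is Han's extension of Foata's bijection. Fix a letter x and call y a
-- marker if U y x = U ℓ x, where ℓ is the last letter of a word v. Cut v into
-- blocks ending in a marker and move each marker to the front of its block. In a
-- bipartitional relation all pairs across the cut between markers and non-markers
-- are related the same way, so every non-marker changes inv′ by the same amount;
-- appending x then raises inv′ by |v|·χ(U ℓ x), which is exactly what appending x
-- adds to maj′. Iterating letter by letter gives a bijection Φ of every
-- rearrangement class with inv′ ∘ Φ = maj′.
--
-- (a ⇒ b) If U x y and U y z but not U x z, the word xyz has maj′ = 3 and
-- inv′ = 2, while every three-letter word with inv′ = 3 has maj′ = 3, so maj′ = 3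
-- is more frequent than inv′ = 3 on the class of xyz. The same argument with the
-- value 0 shows that the complement of U is transitive. Such a relation is a weak
-- order on each of whose classes U is either total or empty, and ranking the
-- classes yields the ordered bipartition.
module Submission where

open import Defs
open import Data.Bool as Bool using (Bool; true; false; not)
import Data.Nat as ℕ
open import Data.Nat using (ℕ; zero; suc; _+_; _*_; _≤_; _<_; s≤s)
open import Data.Nat.Properties
  using (+-identityʳ; +-assoc; +-comm; +-suc; +-cancelʳ-≡; suc-injective; ≤-refl; ≤-trans; ≤-reflexive;
         ≤-pred; n≤1+n; ≤⇒≤′; <-≤-trans; ≤∧≢⇒<; m≤n⇒m<n∨m≡n)
open import Data.Nat.ListAction using (sum)
open import Data.Nat.ListAction.Properties using (sum-++; sum-↭)
open import Data.Nat.Tactic.RingSolver using (solve-∀)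
open import Data.Fin as Fin using (Fin)
import Data.Fin.Properties as Finₚ
open import Data.Fin.Properties using (all?; any?)
open import Data.List
  using (List; []; _∷_; _++_; _∷ʳ_; [_]; length; filter; map; reverse; initLast; _∷ʳ′_;
         concatMap; cartesianProductWith; allFin)
open import Data.List.Properties
  using (map-++; map-cong; ++-assoc; ++-identityʳ; ∷-injective; ∷ʳ-injective;
         length-++; length-map; length-tabulate; length-reverse; length-filter;
         filter-++; filter-all; filter-reject; filter-≐;
         unfold-reverse; reverse-involutive; reverse-injective)
open import Data.List.Relation.Unary.All as All using (All; []; _∷_)
import Data.List.Relation.Unary.All.Properties as All
open import Data.List.Relation.Binary.Permutation.Propositional
  using (_↭_; ↭-refl; ↭-sym; ↭-trans; ↭-reflexive; prep)
import Data.List.Relation.Binary.Permutation.Propositional.Properties as ↭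
open import Data.List.Relation.Binary.BagAndSetEquality using (∼bag⇒↭)
open import Data.List.Membership.Propositional using (_∈_)
open import Data.List.Membership.Propositional.Properties
  using (∈-map⁺; ∈-map⁻; ∈-allFin; ∈-cartesianProductWith⁺; ∈-cartesianProductWith⁻; ∈-filter⁺; ∈-filter⁻)
open import Data.List.Membership.Propositional.Properties.WithK using (unique∧set⇒bag)
open import Data.List.Relation.Unary.Any using (here)
import Data.List.Relation.Unary.AllPairs as AllPairs
open import Data.List.Relation.Binary.Sublist.Propositional using (_⊆_; ⊆-refl)
import Data.List.Relation.Binary.Sublist.Propositional.Properties as Sublist
open import Data.List.Relation.Binary.Equality.Propositional using (≋⇒≡)
open import Data.List.Relation.Unary.Unique.Propositional using (Unique)
import Data.List.Relation.Unary.Unique.Propositional.Properties as Unique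
open import Function.Bundles using (_⇔_; mk⇔; Equivalence)
open import Data.Sum using (_⊎_; inj₁; inj₂)
open import Data.Product as Product using (∃; ∃₂; _×_; _,_; proj₁; proj₂)
open import Data.Bool.Properties using (¬-not)
open import Function using (_∘_; id; case_of_)
open import Level using (0ℓ)
open import Relation.Binary.PropositionalEquality hiding ([_])
open import Relation.Nullary using (¬_; Dec; yes; no; contradiction)
open import Relation.Nullary.Decidable using (_×-dec_)
open import Relation.Binary.Definitions using (tri<; tri≈; tri>)
open import Relation.Unary using (Pred; Decidable; ∁)
open import Relation.Unary.Properties using (∁?)
open ≡-Reasoning

∑ : {A : Set} → (A → ℕ) → List A → ℕ
∑ f xs = sum (map f xs)

module _ {A : Set} where

  ∑-++ : ∀ (f : A → ℕ) xs ys → ∑ f (xs ++ ys) ≡ ∑ f xs + ∑ f ys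
  ∑-++ f xs ys = trans (cong sum (map-++ f xs ys)) (sum-++ (map f xs) (map f ys))

  ∑-↭ : ∀ (f : A → ℕ) {xs ys} → xs ↭ ys → ∑ f xs ≡ ∑ f ys
  ∑-↭ f p = sum-↭ (↭.map⁺ f p)

  ∑-cong : ∀ {f g : A → ℕ} → (∀ a → f a ≡ g a) → ∀ xs → ∑ f xs ≡ ∑ g xs
  ∑-cong f≗g xs = cong sum (map-cong f≗g xs)

  ∑-const : ∀ (f : A → ℕ) {c xs} → All (λ a → f a ≡ c) xs → ∑ f xs ≡ length xs * c
  ∑-const f []            = refl
  ∑-const f (fx≡c ∷ fxs≡c) = cong₂ _+_ fx≡c (∑-const f fxs≡c)

  length-filter-≡true : ∀ (p : A → Bool) xs →
                        length (filter (λ y → p y Bool.≟ true) xs) ≡ ∑ (χ ∘ p) xs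
  length-filter-≡true p []       = refl
  length-filter-≡true p (y ∷ xs) with p y
  ... | true  = cong suc (length-filter-≡true p xs)
  ... | false = length-filter-≡true p xs

module _ {r : ℕ} (U : Relation r) where

  cross : List (Fin r) → List (Fin r) → ℕ
  cross xs ys = ∑ (λ a → ∑ (χ ∘ U a) ys) xs

  inv′-∷ : ∀ x xs → inv′ U (x ∷ xs) ≡ ∑ (χ ∘ U x) xs + inv′ U xs
  inv′-∷ x xs = cong (_+ inv′ U xs) (length-filter-≡true (U x) xs)

  inv′-++ : ∀ xs ys → inv′ U (xs ++ ys) ≡ inv′ U xs + inv′ U ys + cross xs ys
  inv′-++ []       ys = sym (+-identityʳ (inv′ U ys))
  inv′-++ (x ∷ xs) ys = begin
    inv′ U (x ∷ xs ++ ys)                          ≡⟨ inv′-∷ x (xs ++ ys) ⟩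
    ∑ (χ ∘ U x) (xs ++ ys) + inv′ U (xs ++ ys)      ≡⟨ cong₂ _+_ (∑-++ (χ ∘ U x) xs ys) (inv′-++ xs ys) ⟩
    (∑ (χ ∘ U x) xs + ∑ (χ ∘ U x) ys) + (inv′ U xs + inv′ U ys + cross xs ys)
      ≡⟨ shuffle (∑ (χ ∘ U x) xs) (∑ (χ ∘ U x) ys) (inv′ U xs) (inv′ U ys) (cross xs ys) ⟩
    (∑ (χ ∘ U x) xs + inv′ U xs) + inv′ U ys + cross (x ∷ xs) ys
      ≡⟨ cong (λ n → n + inv′ U ys + cross (x ∷ xs) ys) (inv′-∷ x xs) ⟨
    inv′ U (x ∷ xs) + inv′ U ys + cross (x ∷ xs) ys ∎
    where
    shuffle : ∀ a b c d e → (a + b) + (c + d + e) ≡ (a + c) + d + (b + e)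
    shuffle = solve-∀

  cross-↭ : ∀ {xs xs′ ys ys′} → xs ↭ xs′ → ys ↭ ys′ → cross xs ys ≡ cross xs′ ys′
  cross-↭ {xs} xs↭xs′ ys↭ys′ =
    trans (∑-cong (λ a → ∑-↭ (χ ∘ U a) ys↭ys′) xs) (∑-↭ _ xs↭xs′)

  inv′-∷ʳ : ∀ xs y → inv′ U (xs ∷ʳ y) ≡ inv′ U xs + ∑ (λ a → χ (U a y)) xs
  inv′-∷ʳ xs y = trans (inv′-++ xs [ y ])
    (cong₂ _+_ (+-identityʳ (inv′ U xs)) (∑-cong (λ a → +-identityʳ (χ (U a y))) xs))

majFrom-∷ʳ : ∀ {r} (U : Relation r) i u (ℓ x : Fin r) →
             majFrom U i (u ∷ʳ ℓ ∷ʳ x) ≡ majFrom U i (u ∷ʳ ℓ) + (i + length u) * χ (U ℓ x)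
majFrom-∷ʳ U i []          ℓ x = trans (+-identityʳ _) (cong (_* χ (U ℓ x)) (sym (+-identityʳ i)))
majFrom-∷ʳ U i (y ∷ [])    ℓ x = arith i (χ (U y ℓ)) (χ (U ℓ x))
  where
  arith : ∀ i a b → i * a + ((1 + i) * b + 0) ≡ i * a + 0 + (i + 1) * b
  arith = solve-∀
majFrom-∷ʳ U i (y ∷ z ∷ u) ℓ x = begin
  i * χ (U y z) + majFrom U (suc i) (z ∷ u ∷ʳ ℓ ∷ʳ x)
    ≡⟨ cong (i * χ (U y z) +_) (majFrom-∷ʳ U (suc i) (z ∷ u) ℓ x) ⟩
  i * χ (U y z) + (majFrom U (suc i) (z ∷ u ∷ʳ ℓ) + (suc i + length (z ∷ u)) * χ (U ℓ x))
    ≡⟨ +-assoc (i * χ (U y z)) _ _ ⟨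
  majFrom U i (y ∷ z ∷ u ∷ʳ ℓ) + (suc i + length (z ∷ u)) * χ (U ℓ x)
    ≡⟨ cong (λ n → majFrom U i (y ∷ z ∷ u ∷ʳ ℓ) + n * χ (U ℓ x)) (+-suc i (length (z ∷ u))) ⟨
  majFrom U i (y ∷ z ∷ u ∷ʳ ℓ) + (i + length (y ∷ z ∷ u)) * χ (U ℓ x) ∎

-- Block rotation

-- `rotate acc v` cuts v into blocks, each ending in its only P-letter, and moves
-- that letter to the front of its block; acc is the P-free beginning of the
-- current block. `unrotate b acc` undoes this, b being the P-letter that heads the
-- current block.
module BlockRotation {A : Set} {P : Pred A 0ℓ} (P? : Decidable P) where

  rotate : List A → List A → List A
  rotate acc []       = acc
  rotate acc (y ∷ ys) with P? y
  ... | yes _ = y ∷ acc ++ rotate [] ys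
  ... | no  _ = rotate (acc ∷ʳ y) ys

  unrotate : A → List A → List A → List A
  unrotate b acc []       = acc ∷ʳ b
  unrotate b acc (y ∷ ys) with P? y
  ... | yes _ = acc ++ b ∷ unrotate y [] ys
  ... | no  _ = unrotate b (acc ∷ʳ y) ys

  nonMarkers : List A → ℕ
  nonMarkers xs = length (filter (∁? P?) xs)

  rotate-↭ : ∀ acc v → rotate acc v ↭ acc ++ v
  rotate-↭ acc []       = ↭-reflexive (sym (++-identityʳ acc))
  rotate-↭ acc (y ∷ ys) with P? y
  ... | yes _ = ↭-trans (prep y (↭.++⁺ˡ acc (rotate-↭ [] ys))) (↭-sym (↭.shift y acc ys))
  ... | no  _ = ↭-trans (rotate-↭ (acc ∷ʳ y) ys) (↭-reflexive (++-assoc acc [ y ] ys))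

  rotate-skip : ∀ acc {as} v → All (∁ P) as → rotate acc (as ++ v) ≡ rotate (acc ++ as) v
  rotate-skip acc v [] = cong (λ xs → rotate xs v) (sym (++-identityʳ acc))
  rotate-skip acc v (_∷_ {a} {as} ¬pa ¬pas) with P? a
  ... | yes pa = contradiction pa ¬pa
  ... | no  _  = trans (rotate-skip (acc ∷ʳ a) v ¬pas)
                       (cong (λ xs → rotate xs v) (++-assoc acc [ a ] as))

  unrotate-skip : ∀ b acc {as} v → All (∁ P) as → unrotate b acc (as ++ v) ≡ unrotate b (acc ++ as) v
  unrotate-skip b acc v [] = cong (λ xs → unrotate b xs v) (sym (++-identityʳ acc))
  unrotate-skip b acc v (_∷_ {a} {as} ¬pa ¬pas) with P? a
  ... | yes pa = contradiction pa ¬pa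
  ... | no  _  = trans (unrotate-skip b (acc ∷ʳ a) v ¬pas)
                       (cong (λ xs → unrotate b xs v) (++-assoc acc [ a ] as))

  rotate-marker : ∀ {y} → P y → ∀ acc ys → rotate acc (y ∷ ys) ≡ y ∷ acc ++ rotate [] ys
  rotate-marker {y} py acc ys with P? y
  ... | yes _  = refl
  ... | no ¬py = contradiction py ¬py

  unrotate-marker : ∀ {y} → P y → ∀ b acc ys → unrotate b acc (y ∷ ys) ≡ acc ++ b ∷ unrotate y [] ys
  unrotate-marker {y} py b acc ys with P? y
  ... | yes _  = refl
  ... | no ¬py = contradiction py ¬py

  unrotate-rotate : ∀ {ℓ} → P ℓ → ∀ u b A {acc} → All (∁ P) acc →
                    unrotate b A (rotate acc (u ∷ʳ ℓ)) ≡ A ++ b ∷ acc ++ u ∷ʳ ℓ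
  unrotate-rotate {ℓ} pℓ [] b A {acc} ¬pacc = begin
    unrotate b A (rotate acc [ ℓ ])       ≡⟨ cong (unrotate b A) (rotate-marker pℓ acc []) ⟩
    unrotate b A (ℓ ∷ acc ++ [])          ≡⟨ unrotate-marker pℓ b A (acc ++ []) ⟩
    A ++ b ∷ unrotate ℓ [] (acc ++ [])    ≡⟨ cong (λ xs → A ++ b ∷ xs) (unrotate-skip ℓ [] [] ¬pacc) ⟩
    A ++ b ∷ acc ∷ʳ ℓ                     ∎
  unrotate-rotate {ℓ} pℓ (y ∷ u) b A {acc} ¬pacc with P? y
  ... | yes py = begin
    unrotate b A (y ∷ acc ++ rotate [] (u ∷ʳ ℓ))  ≡⟨ unrotate-marker py b A _ ⟩
    A ++ b ∷ unrotate y [] (acc ++ rotate [] (u ∷ʳ ℓ))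
      ≡⟨ cong (λ xs → A ++ b ∷ xs) (unrotate-skip y [] _ ¬pacc) ⟩
    A ++ b ∷ unrotate y acc (rotate [] (u ∷ʳ ℓ))
      ≡⟨ cong (λ xs → A ++ b ∷ xs) (unrotate-rotate pℓ u y acc []) ⟩
    A ++ b ∷ acc ++ y ∷ u ∷ʳ ℓ                    ∎
  ... | no ¬py = trans (unrotate-rotate pℓ u b A (All.∷ʳ⁺ ¬pacc ¬py))
                   (cong (λ xs → A ++ b ∷ xs) (++-assoc acc [ y ] (u ∷ʳ ℓ)))

  rotate-view : ∀ {ℓ} → P ℓ → ∀ u {acc} → All (∁ P) acc →
                ∃₂ λ b rest → rotate acc (u ∷ʳ ℓ) ≡ b ∷ rest × P b × unrotate b [] rest ≡ acc ++ u ∷ʳ ℓ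
  rotate-view {ℓ} pℓ [] {acc} ¬pacc =
    ℓ , acc ++ [] , rotate-marker pℓ acc [] , pℓ , unrotate-skip ℓ [] [] ¬pacc
  rotate-view {ℓ} pℓ (y ∷ u) {acc} ¬pacc with P? y
  ... | yes py = y , acc ++ rotate [] (u ∷ʳ ℓ) , refl , py ,
                 trans (unrotate-skip y [] _ ¬pacc) (unrotate-rotate pℓ u y acc [])
  ... | no ¬py with b , rest , rot≡ , pb , unrot≡ ← rotate-view pℓ u (All.∷ʳ⁺ ¬pacc ¬py) =
                 b , rest , rot≡ , pb , trans unrot≡ (++-assoc acc [ y ] (u ∷ʳ ℓ))

  rotate-unrotate : ∀ {b} → P b → ∀ rest A acc → All (∁ P) A →
                    rotate acc (unrotate b A rest) ≡ b ∷ acc ++ A ++ rest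
  rotate-unrotate {b} pb [] A acc ¬pA = begin
    rotate acc (A ++ [ b ])     ≡⟨ rotate-skip acc [ b ] ¬pA ⟩
    rotate (acc ++ A) [ b ]     ≡⟨ rotate-marker pb (acc ++ A) [] ⟩
    b ∷ (acc ++ A) ++ []        ≡⟨ cong (b ∷_) (++-assoc acc A []) ⟩
    b ∷ acc ++ A ++ []          ∎
  rotate-unrotate {b} pb (y ∷ ys) A acc ¬pA with P? y
  ... | yes py = begin
    rotate acc (A ++ b ∷ unrotate y [] ys)       ≡⟨ rotate-skip acc _ ¬pA ⟩
    rotate (acc ++ A) (b ∷ unrotate y [] ys)     ≡⟨ rotate-marker pb (acc ++ A) _ ⟩
    b ∷ (acc ++ A) ++ rotate [] (unrotate y [] ys)
      ≡⟨ cong (λ xs → b ∷ (acc ++ A) ++ xs) (rotate-unrotate py ys [] [] []) ⟩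
    b ∷ (acc ++ A) ++ y ∷ ys                     ≡⟨ cong (b ∷_) (++-assoc acc A (y ∷ ys)) ⟩
    b ∷ acc ++ A ++ y ∷ ys                       ∎
  ... | no ¬py = trans (rotate-unrotate pb ys (A ∷ʳ y) acc (All.∷ʳ⁺ ¬pA ¬py))
                   (cong (λ xs → b ∷ acc ++ xs) (++-assoc A [ y ] ys))

  unrotate-∷ʳ : ∀ {b} → P b → ∀ rest A → ∃₂ λ pre c → unrotate b A rest ≡ pre ∷ʳ c × P c
  unrotate-∷ʳ {b} pb []       A = A , b , refl , pb
  unrotate-∷ʳ {b} pb (y ∷ ys) A with P? y
  ... | no _   = unrotate-∷ʳ pb ys (A ∷ʳ y)
  ... | yes py with pre , c , unrot≡ , pc ← unrotate-∷ʳ py ys [] =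
    A ++ b ∷ pre , c , trans (cong (λ xs → A ++ b ∷ xs) unrot≡) (sym (++-assoc A (b ∷ pre) [ c ])) , pc

  nonMarkers-++ : ∀ xs ys → nonMarkers (xs ++ ys) ≡ nonMarkers xs + nonMarkers ys
  nonMarkers-++ xs ys = trans (cong length (filter-++ (∁? P?) xs ys)) (length-++ (filter (∁? P?) xs))

  nonMarkers-all : ∀ {xs} → All (∁ P) xs → nonMarkers xs ≡ length xs
  nonMarkers-all ¬pxs = cong length (filter-all (∁? P?) ¬pxs)

  nonMarkers-marker : ∀ {y} → P y → ∀ ys → nonMarkers (y ∷ ys) ≡ nonMarkers ys
  nonMarkers-marker py ys = cong length (filter-reject (∁? P?) (λ ¬py → ¬py py))

  nonMarkers-block : ∀ {acc y} → All (∁ P) acc → P y → ∀ v →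
                     nonMarkers (acc ++ y ∷ v) ≡ length acc + nonMarkers v
  nonMarkers-block {acc} ¬pacc py v =
    trans (nonMarkers-++ acc (_ ∷ v)) (cong₂ _+_ (nonMarkers-all ¬pacc) (nonMarkers-marker py v))

  ∑-by-marker : ∀ (f : A → ℕ) {c d} → (∀ {a} → P a → f a ≡ c) → (∀ {a} → ¬ P a → f a ≡ d) →
                ∀ xs → ∑ f xs + nonMarkers xs * c ≡ length xs * c + nonMarkers xs * d
  ∑-by-marker f f≡c f≡d []       = refl
  ∑-by-marker f {c} {d} f≡c f≡d (y ∷ ys) with P? y
  ... | yes py = begin
    f y + ∑ f ys + nonMarkers ys * c      ≡⟨ cong (λ n → n + ∑ f ys + nonMarkers ys * c) (f≡c py) ⟩
    c + ∑ f ys + nonMarkers ys * c        ≡⟨ +-assoc c _ _ ⟩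
    c + (∑ f ys + nonMarkers ys * c)      ≡⟨ cong (c +_) (∑-by-marker f f≡c f≡d ys) ⟩
    c + (length ys * c + nonMarkers ys * d) ≡⟨ +-assoc c _ _ ⟨
    c + length ys * c + nonMarkers ys * d ∎
  ... | no ¬py = begin
    f y + ∑ f ys + (c + nonMarkers ys * c)  ≡⟨ cong (λ n → n + ∑ f ys + (c + nonMarkers ys * c)) (f≡d ¬py) ⟩
    d + ∑ f ys + (c + nonMarkers ys * c)    ≡⟨ shuffle d (∑ f ys) c (nonMarkers ys * c) ⟩
    c + (∑ f ys + nonMarkers ys * c) + d    ≡⟨ cong (λ n → c + n + d) (∑-by-marker f f≡c f≡d ys) ⟩
    c + (length ys * c + nonMarkers ys * d) + d ≡⟨ shuffle′ c (length ys * c) (nonMarkers ys * d) d ⟩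
    c + length ys * c + (d + nonMarkers ys * d) ∎
    where
    shuffle : ∀ d s c mc → d + s + (c + mc) ≡ c + (s + mc) + d
    shuffle = solve-∀
    shuffle′ : ∀ c lc md d → c + (lc + md) + d ≡ c + lc + (d + md)
    shuffle′ = solve-∀

module _ {r : ℕ} (U : Relation r) {P : Pred (Fin r) 0ℓ} (P? : Decidable P) {β₁ β₂ : Bool}
         (crossing : ∀ {a b} → ¬ P a → P b → U a b ≡ β₁ × U b a ≡ β₂) where
  open BlockRotation P?

  inv′-rotate-block : ∀ {b as} → P b → All (∁ P) as →
                      inv′ U (b ∷ as) + length as * χ β₁ ≡ inv′ U (as ∷ʳ b) + length as * χ β₂
  inv′-rotate-block {b} {as} pb ¬pas = begin
    inv′ U (b ∷ as) + length as * χ β₁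
      ≡⟨ cong (_+ length as * χ β₁) (inv′-∷ U b as) ⟩
    ∑ (χ ∘ U b) as + inv′ U as + length as * χ β₁
      ≡⟨ cong (λ n → n + inv′ U as + length as * χ β₁)
              (∑-const (χ ∘ U b) (All.map (λ ¬pa → cong χ (proj₂ (crossing ¬pa pb))) ¬pas)) ⟩
    length as * χ β₂ + inv′ U as + length as * χ β₁
      ≡⟨ shuffle (length as * χ β₂) (inv′ U as) (length as * χ β₁) ⟩
    inv′ U as + length as * χ β₁ + length as * χ β₂
      ≡⟨ cong (λ n → inv′ U as + n + length as * χ β₂)
              (∑-const (λ a → χ (U a b)) (All.map (λ ¬pa → cong χ (proj₁ (crossing ¬pa pb))) ¬pas)) ⟨
    inv′ U as + ∑ (λ a → χ (U a b)) as + length as * χ β₂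
      ≡⟨ cong (_+ length as * χ β₂) (inv′-∷ʳ U as b) ⟨
    inv′ U (as ∷ʳ b) + length as * χ β₂ ∎
    where
    shuffle : ∀ a b c → a + b + c ≡ b + c + a
    shuffle = solve-∀

  inv′-rotate : ∀ {ℓ} → P ℓ → ∀ u {acc} → All (∁ P) acc →
                let m = nonMarkers (acc ++ u ∷ʳ ℓ) in
                inv′ U (rotate acc (u ∷ʳ ℓ)) + m * χ β₁ ≡ inv′ U (acc ++ u ∷ʳ ℓ) + m * χ β₂
  inv′-rotate {ℓ} pℓ [] {acc} ¬pacc = begin
    inv′ U (rotate acc [ ℓ ]) + m * χ β₁
      ≡⟨ cong₂ (λ w n → inv′ U w + n * χ β₁)
               (trans (rotate-marker pℓ acc []) (cong (ℓ ∷_) (++-identityʳ acc))) m≡ ⟩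
    inv′ U (ℓ ∷ acc) + length acc * χ β₁     ≡⟨ inv′-rotate-block pℓ ¬pacc ⟩
    inv′ U (acc ∷ʳ ℓ) + length acc * χ β₂   ≡⟨ cong (λ n → inv′ U (acc ∷ʳ ℓ) + n * χ β₂) m≡ ⟨
    inv′ U (acc ∷ʳ ℓ) + m * χ β₂            ∎
    where
    m = nonMarkers (acc ∷ʳ ℓ)
    m≡ : m ≡ length acc
    m≡ = trans (nonMarkers-block ¬pacc pℓ []) (+-identityʳ (length acc))
  inv′-rotate {ℓ} pℓ (y ∷ u) {acc} ¬pacc with P? y
  ... | yes py = begin
    inv′ U (y ∷ acc ++ G) + m * χ β₁
      ≡⟨ cong₂ (λ n k → n + k * χ β₁) (inv′-++ U (y ∷ acc) G) m≡ ⟩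
    inv′ U (y ∷ acc) + inv′ U G + cross U (y ∷ acc) G + (length acc + n) * χ β₁
      ≡⟨ regroup (inv′ U (y ∷ acc)) (inv′ U G) (cross U (y ∷ acc) G) (length acc) n (χ β₁) ⟩
    (inv′ U (y ∷ acc) + length acc * χ β₁) + (inv′ U G + n * χ β₁) + cross U (y ∷ acc) G
      ≡⟨ cong₂ _+_ (cong₂ _+_ (inv′-rotate-block py ¬pacc) (inv′-rotate pℓ u []))
                   (cross-↭ U (↭.∷↭∷ʳ y acc) (rotate-↭ [] (u ∷ʳ ℓ))) ⟩
    (inv′ U (acc ∷ʳ y) + length acc * χ β₂) + (inv′ U v + n * χ β₂) + cross U (acc ∷ʳ y) v
      ≡⟨ regroup (inv′ U (acc ∷ʳ y)) (inv′ U v) (cross U (acc ∷ʳ y) v) (length acc) n (χ β₂) ⟨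
    inv′ U (acc ∷ʳ y) + inv′ U v + cross U (acc ∷ʳ y) v + (length acc + n) * χ β₂
      ≡⟨ cong₂ (λ n k → n + k * χ β₂)
               (trans (cong (inv′ U) (sym (++-assoc acc [ y ] v))) (inv′-++ U (acc ∷ʳ y) v)) m≡ ⟨
    inv′ U (acc ++ y ∷ v) + m * χ β₂ ∎
    where
    v = u ∷ʳ ℓ
    G = rotate [] v
    n = nonMarkers v
    m = nonMarkers (acc ++ y ∷ v)
    m≡ : m ≡ length acc + n
    m≡ = nonMarkers-block ¬pacc py v
    regroup : ∀ a b c l n k → a + b + c + (l + n) * k ≡ (a + l * k) + (b + n * k) + c
    regroup = solve-∀
  ... | no ¬py =
    subst (λ w → inv′ U (rotate (acc ∷ʳ y) (u ∷ʳ ℓ)) + nonMarkers w * χ β₁ ≡ inv′ U w + nonMarkers w * χ β₂)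
          (++-assoc acc [ y ] (u ∷ʳ ℓ)) (inv′-rotate pℓ u (All.∷ʳ⁺ ¬pacc ¬py))

-- Foata's bijection

Separated : ∀ {r} → Relation r → Set
Separated {r} U = ∀ {a b x : Fin r} → U b x ≡ true → U a x ≡ false → U b a ≡ true × U a b ≡ false

module FoataStep {r : ℕ} (U : Relation r) (sep : Separated U) (x : Fin r) where

  marker? : (s : Bool) → Decidable (λ y → U y x ≡ s)
  marker? s y = U y x Bool.≟ s

  module Rot (s : Bool) = BlockRotation (marker? s)

  γ : Bool → List (Fin r) → List (Fin r)
  γ s = Rot.rotate s []

  crossing : ∀ s {a b} → U a x ≢ s → U b x ≡ s → U a b ≡ not s × U b a ≡ s
  crossing true  ¬pa pb = Product.swap (sep pb (¬-not ¬pa))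
  crossing false ¬pa pb = sep (¬-not ¬pa) pb

  -- If v has m non-markers, rotation trades m·χ(not s) inversions for m·χ s, and
  -- x follows (|v| − m)·χ s + m·χ(not s) letters y with U y x; adding
  -- m·(χ(not s) + χ s) to both sides avoids the subtraction.
  inv′-γ-∷ʳ : ∀ u ℓ → let s = U ℓ x ; v = u ∷ʳ ℓ in
              inv′ U (γ s v ∷ʳ x) ≡ inv′ U v + length v * χ s
  inv′-γ-∷ʳ u ℓ = +-cancelʳ-≡ (m * χ (not s) + m * χ s) _ _ (begin
    inv′ U (γ s v ∷ʳ x) + (m * χ (not s) + m * χ s)
      ≡⟨ cong (_+ (m * χ (not s) + m * χ s)) (inv′-∷ʳ U (γ s v) x) ⟩
    inv′ U (γ s v) + ∑ (λ a → χ (U a x)) (γ s v) + (m * χ (not s) + m * χ s)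
      ≡⟨ cong (λ n → inv′ U (γ s v) + n + (m * χ (not s) + m * χ s)) (∑-↭ _ (Rot.rotate-↭ s [] v)) ⟩
    inv′ U (γ s v) + ∑ (λ a → χ (U a x)) v + (m * χ (not s) + m * χ s)
      ≡⟨ shuffle (inv′ U (γ s v)) (∑ (λ a → χ (U a x)) v) (m * χ (not s)) (m * χ s) ⟩
    (inv′ U (γ s v) + m * χ (not s)) + (∑ (λ a → χ (U a x)) v + m * χ s)
      ≡⟨ cong₂ _+_ (inv′-rotate U (marker? s) (crossing s) refl u [])
                   (Rot.∑-by-marker s (λ a → χ (U a x)) (cong χ) (λ ¬pa → cong χ (¬-not ¬pa)) v) ⟩
    (inv′ U v + m * χ s) + (length v * χ s + m * χ (not s))
      ≡⟨ shuffle′ (inv′ U v) (m * χ s) (length v * χ s) (m * χ (not s)) ⟩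
    inv′ U v + length v * χ s + (m * χ (not s) + m * χ s) ∎)
    where
    s = U ℓ x
    v = u ∷ʳ ℓ
    m = Rot.nonMarkers s v
    shuffle : ∀ a b c d → a + b + (c + d) ≡ (a + c) + (b + d)
    shuffle = solve-∀
    shuffle′ : ∀ a b c d → (a + b) + (c + d) ≡ a + c + (d + b)
    shuffle′ = solve-∀

  length-γ : ∀ s v → length (γ s v) ≡ length v
  length-γ s v = ↭.↭-length (Rot.rotate-↭ s [] v)

  γ-cancel : ∀ {u u′ ℓ ℓ′} → γ (U ℓ x) (u ∷ʳ ℓ) ≡ γ (U ℓ′ x) (u′ ∷ʳ ℓ′) → u ∷ʳ ℓ ≡ u′ ∷ʳ ℓ′
  γ-cancel {u} {u′} {ℓ} {ℓ′} γ≡γ′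
    with b , rest , γ≡ , pb , unrot≡ ← Rot.rotate-view (U ℓ x) refl u []
       | b′ , rest′ , γ′≡ , pb′ , unrot′≡ ← Rot.rotate-view (U ℓ′ x) refl u′ []
    with refl , refl ← ∷-injective (trans (sym γ≡) (trans γ≡γ′ γ′≡))
    = trans (sym unrot≡) (trans (cong (λ s → Rot.unrotate s b [] rest) (trans (sym pb) pb′)) unrot′≡)

  γ-surjective : ∀ b rest → ∃₂ λ u ℓ → γ (U ℓ x) (u ∷ʳ ℓ) ≡ b ∷ rest
  γ-surjective b rest with pre , c , unrot≡ , pc ← Rot.unrotate-∷ʳ (U b x) refl rest [] =
    pre , c , (begin
      γ (U c x) (pre ∷ʳ c)                    ≡⟨ cong (λ s → γ s (pre ∷ʳ c)) pc ⟩
      γ (U b x) (pre ∷ʳ c)                    ≡⟨ cong (γ (U b x)) unrot≡ ⟨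
      γ (U b x) (Rot.unrotate (U b x) b [] rest) ≡⟨ Rot.rotate-unrotate (U b x) refl rest [] [] [] ⟩
      b ∷ rest                                ∎)

-- Φʳ takes a word reversed: it keeps the last letter x last and applies γ x to
-- the image of the rest, which is `stem x`.
module Foata {r : ℕ} (U : Relation r) (sep : Separated U) where
  open module Step (x : Fin r) = FoataStep U sep x using (γ)

  stem : Fin r → List (Fin r) → List (Fin r)
  stem x []       = []
  stem x (ℓ ∷ rv) = γ x (U ℓ x) (stem ℓ rv ∷ʳ ℓ)

  Φʳ : List (Fin r) → List (Fin r)
  Φʳ []       = []
  Φʳ (x ∷ rv) = stem x rv ∷ʳ x

  stem-↭ : ∀ x rv → stem x rv ↭ rv
  stem-↭ x []       = ↭-refl
  stem-↭ x (ℓ ∷ rv) = ↭-trans (Step.Rot.rotate-↭ x (U ℓ x) [] (stem ℓ rv ∷ʳ ℓ))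
                        (↭-trans (↭-sym (↭.∷↭∷ʳ ℓ (stem ℓ rv))) (prep ℓ (stem-↭ ℓ rv)))

  Φʳ-↭ : ∀ rv → Φʳ rv ↭ rv
  Φʳ-↭ []       = ↭-refl
  Φʳ-↭ (x ∷ rv) = ↭-trans (↭-sym (↭.∷↭∷ʳ x (stem x rv))) (prep x (stem-↭ x rv))

  length-Φʳ : ∀ rv → length (Φʳ rv) ≡ length rv
  length-Φʳ rv = ↭.↭-length (Φʳ-↭ rv)

  inv′-Φʳ : ∀ rv → inv′ U (Φʳ rv) ≡ maj′ U (reverse rv)
  inv′-Φʳ []           = refl
  inv′-Φʳ (x ∷ [])     = refl
  inv′-Φʳ (x ∷ ℓ ∷ rv) = begin
    inv′ U (γ x (U ℓ x) (Φʳ (ℓ ∷ rv)) ∷ʳ x)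
      ≡⟨ Step.inv′-γ-∷ʳ x (stem ℓ rv) ℓ ⟩
    inv′ U (Φʳ (ℓ ∷ rv)) + length (Φʳ (ℓ ∷ rv)) * χ (U ℓ x)
      ≡⟨ cong₂ (λ m n → m + n * χ (U ℓ x)) (inv′-Φʳ (ℓ ∷ rv))
               (trans (length-Φʳ (ℓ ∷ rv)) (cong suc (sym (length-reverse rv)))) ⟩
    maj′ U (reverse (ℓ ∷ rv)) + (1 + length (reverse rv)) * χ (U ℓ x)
      ≡⟨ cong (λ w → maj′ U w + (1 + length (reverse rv)) * χ (U ℓ x)) (unfold-reverse ℓ rv) ⟩
    maj′ U (reverse rv ∷ʳ ℓ) + (1 + length (reverse rv)) * χ (U ℓ x)
      ≡⟨ majFrom-∷ʳ U 1 (reverse rv) ℓ x ⟨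
    maj′ U (reverse rv ∷ʳ ℓ ∷ʳ x)
      ≡⟨ cong (λ w → maj′ U (w ∷ʳ x)) (unfold-reverse ℓ rv) ⟨
    maj′ U (reverse (ℓ ∷ rv) ∷ʳ x)
      ≡⟨ cong (maj′ U) (unfold-reverse x (ℓ ∷ rv)) ⟨
    maj′ U (reverse (x ∷ ℓ ∷ rv)) ∎

  mutual
    Φʳ-injective : ∀ {rv rv′} → Φʳ rv ≡ Φʳ rv′ → rv ≡ rv′
    Φʳ-injective {[]}     {[]}       _ = refl
    Φʳ-injective {[]}     {x′ ∷ rv′} e with () ← trans (cong length e) (length-Φʳ (x′ ∷ rv′))
    Φʳ-injective {x ∷ rv} {[]}       e with () ← trans (sym (length-Φʳ (x ∷ rv))) (cong length e)
    Φʳ-injective {x ∷ rv} {x′ ∷ rv′} e with stem≡ , refl ← ∷ʳ-injective (stem x rv) (stem x′ rv′) e =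
      cong (x ∷_) (stem-injective stem≡)

    stem-injective : ∀ {x rv rv′} → stem x rv ≡ stem x rv′ → rv ≡ rv′
    stem-injective {x} {[]}     {[]}       _ = refl
    stem-injective {x} {[]}     {ℓ′ ∷ rv′} e
      with () ← trans (cong length e) (↭.↭-length (stem-↭ x (ℓ′ ∷ rv′)))
    stem-injective {x} {ℓ ∷ rv} {[]}       e
      with () ← trans (sym (↭.↭-length (stem-↭ x (ℓ ∷ rv)))) (cong length e)
    stem-injective {x} {ℓ ∷ rv} {ℓ′ ∷ rv′} e = Φʳ-injective (Step.γ-cancel x e)

  stem-surjective : ∀ x n w → length w ≡ n → ∃ λ rv → stem x rv ≡ w
  stem-surjective x _       []         _    = [] , refl
  stem-surjective x (suc n) (b ∷ rest) len≡
    with u , ℓ , γ≡ ← Step.γ-surjective x b rest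
    with rv , stem≡ ← stem-surjective ℓ n u (suc-injective (begin
      suc (length u)                  ≡⟨ +-comm 1 (length u) ⟩
      length u + 1                    ≡⟨ length-++ u ⟨
      length (u ∷ʳ ℓ)                 ≡⟨ Step.length-γ x (U ℓ x) (u ∷ʳ ℓ) ⟨
      length (γ x (U ℓ x) (u ∷ʳ ℓ))   ≡⟨ cong length γ≡ ⟩
      length (b ∷ rest)               ≡⟨ len≡ ⟩
      suc n                           ∎))
    = ℓ ∷ rv , trans (cong (λ w → γ x (U ℓ x) (w ∷ʳ ℓ)) stem≡) γ≡

  Φʳ-surjective : ∀ w → ∃ λ rv → Φʳ rv ≡ w
  Φʳ-surjective w with initLast w
  ... | []       = [] , refl
  ... | w′ ∷ʳ′ x with rv , stem≡ ← stem-surjective x (length w′) w′ refl =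
    x ∷ rv , cong (_∷ʳ x) stem≡

  Φ : List (Fin r) → List (Fin r)
  Φ w = Φʳ (reverse w)

  Φ-↭ : ∀ w → Φ w ↭ w
  Φ-↭ w = ↭-trans (Φʳ-↭ (reverse w)) (↭.↭-reverse w)

  inv′-Φ : ∀ w → inv′ U (Φ w) ≡ maj′ U w
  inv′-Φ w = trans (inv′-Φʳ (reverse w)) (cong (maj′ U) (reverse-involutive w))

  Φ-injective : ∀ {v w} → Φ v ≡ Φ w → v ≡ w
  Φ-injective e = reverse-injective (Φʳ-injective e)

  Φ-surjective : ∀ w → ∃ λ v → Φ v ≡ w
  Φ-surjective w with rv , Φʳrv≡w ← Φʳ-surjective w =
    reverse rv , trans (cong Φʳ (reverse-involutive rv)) Φʳrv≡w

concatMap≡cartesianProductWith : ∀ {A B C : Set} (f : A → B → C) xs ys →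
                                 concatMap (λ x → map (f x) ys) xs ≡ cartesianProductWith f xs ys
concatMap≡cartesianProductWith f []       ys = refl
concatMap≡cartesianProductWith f (x ∷ xs) ys =
  cong (map (f x) ys ++_) (concatMap≡cartesianProductWith f xs ys)

module _ {r : ℕ} where

  allWords-suc : ∀ n → allWords r (suc n) ≡ cartesianProductWith (λ w a → a ∷ w) (allWords r n) (allFin r)
  allWords-suc n = concatMap≡cartesianProductWith (λ w a → a ∷ w) (allWords r n) (allFin r)

  allWords-unique : ∀ n → Unique (allWords r n)
  allWords-unique zero    = [] AllPairs.∷ AllPairs.[]
  allWords-unique (suc n) = subst Unique (sym (allWords-suc n))
    (Unique.cartesianProductWith⁺ _ (λ e → Product.swap (∷-injective e))
                                  (allWords-unique n) (Unique.allFin⁺ r))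

  ∈-allWords⁺ : ∀ w → w ∈ allWords r (length w)
  ∈-allWords⁺ []      = here refl
  ∈-allWords⁺ (x ∷ w) = subst (x ∷ w ∈_) (sym (allWords-suc (length w)))
    (∈-cartesianProductWith⁺ (λ w a → a ∷ w) (∈-allWords⁺ w) (∈-allFin x))

  ∈-allWords⁻ : ∀ n {w} → w ∈ allWords r n → length w ≡ n
  ∈-allWords⁻ zero    (here refl) = refl
  ∈-allWords⁻ (suc n) w∈ with v , x , v∈ , _ , refl ←
    ∈-cartesianProductWith⁻ (λ w a → a ∷ w) (allWords r n) (allFin r) (subst (_ ∈_) (allWords-suc n) w∈) =
    cong suc (∈-allWords⁻ n v∈)

  map-allWords-↭ : ∀ (f : List (Fin r) → List (Fin r)) → (∀ {v w} → f v ≡ f w → v ≡ w) →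
                   (∀ w → length (f w) ≡ length w) → (∀ w → ∃ λ v → f v ≡ w) →
                   ∀ n → map f (allWords r n) ↭ allWords r n
  map-allWords-↭ f f-injective length-f f-surjective n =
    ∼bag⇒↭ (unique∧set⇒bag (Unique.map⁺ f-injective (allWords-unique n)) (allWords-unique n) (mk⇔ to from))
    where
    ∈-allWords : ∀ {w} → length w ≡ n → w ∈ allWords r n
    ∈-allWords {w} refl = ∈-allWords⁺ w
    to : ∀ {w} → w ∈ map f (allWords r n) → w ∈ allWords r n
    to w∈ with v , v∈ , refl ← ∈-map⁻ f w∈ = ∈-allWords (trans (length-f v) (∈-allWords⁻ n v∈))
    from : ∀ {w} → w ∈ allWords r n → w ∈ map f (allWords r n)
    from {w} w∈ with v , refl ← f-surjective w =
      ∈-map⁺ f (∈-allWords (trans (sym (length-f v)) (∈-allWords⁻ n w∈)))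

module _ {A : Set} {Q : Pred A 0ℓ} (Q? : Decidable Q) (f : A → A) where

  filter-map : ∀ xs → filter Q? (map f xs) ≡ map f (filter (Q? ∘ f) xs)
  filter-map []       = refl
  filter-map (x ∷ xs) with Q? (f x)
  ... | yes _ = cong (f x ∷_) (filter-map xs)
  ... | no  _ = filter-map xs

  length-filter-reindex : ∀ {P : Pred A 0ℓ} (P? : Decidable P) {xs} → map f xs ↭ xs →
                          (∀ {x} → P x → Q (f x)) → (∀ {x} → Q (f x) → P x) →
                          length (filter P? xs) ≡ length (filter Q? xs)
  length-filter-reindex P? {xs} fxs↭xs P⇒Qf Qf⇒P = begin
    length (filter P? xs)             ≡⟨ cong length (filter-≐ P? (Q? ∘ f) (P⇒Qf , Qf⇒P) xs) ⟩
    length (filter (Q? ∘ f) xs)       ≡⟨ length-map f (filter (Q? ∘ f) xs) ⟨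
    length (map f (filter (Q? ∘ f) xs)) ≡⟨ cong length (filter-map xs) ⟨
    length (filter Q? (map f xs))     ≡⟨ ↭.↭-length (↭.filter-↭ Q? fxs↭xs) ⟩
    length (filter Q? xs)             ∎

separated⇒equidistributed : ∀ {r} (U : Relation r) → Separated U → Equidistributed U
separated⇒equidistributed {r} U sep c k =
  length-filter-reindex _ Φ _ (map-allWords-↭ Φ Φ-injective length-Φ Φ-surjective (total c))
    (λ {w} → Product.map (λ occ≡ i → trans (occ-Φ i w) (occ≡ i)) (trans (inv′-Φ w)))
    (λ {w} → Product.map (λ occ≡ i → trans (sym (occ-Φ i w)) (occ≡ i)) (trans (sym (inv′-Φ w))))
  where
  open Foata U sep
  length-Φ : ∀ w → length (Φ w) ≡ length w
  length-Φ w = ↭.↭-length (Φ-↭ w)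
  occ-Φ : ∀ i w → occ i (Φ w) ≡ occ i w
  occ-Φ i w = ↭.↭-length (↭.filter-↭ (Fin._≟ i) (Φ-↭ w))

bipartitional⇒separated : ∀ {r} (U : Relation r) → Bipartitional U → Separated U
bipartitional⇒separated U (m , f , β , _ , U⇔) {a} {b} {x} Ubx Uax = from (inj₁ fb<fa) , Uab≡false
  where
  from : ∀ {y z} → f y Fin.< f z ⊎ (f y ≡ f z × β (f y) ≡ true) → U y z ≡ true
  from {y} {z} = Equivalence.from (U⇔ y z)
  ¬Uax : ¬ (f a Fin.< f x ⊎ (f a ≡ f x × β (f a) ≡ true))
  ¬Uax h with () ← trans (sym (from h)) Uax
  fb<fa : f b Fin.< f a
  fb<fa with Finₚ.<-cmp (f x) (f a) | Equivalence.to (U⇔ b x) Ubx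
  ... | tri< fx<fa _ _ | inj₁ fb<fx        = Finₚ.<-trans fb<fx fx<fa
  ... | tri< fx<fa _ _ | inj₂ (fb≡fx , _)  = subst (Fin._< f a) (sym fb≡fx) fx<fa
  ... | tri≈ _ fx≡fa _ | inj₁ fb<fx        = subst (f b Fin.<_) fx≡fa fb<fx
  ... | tri≈ _ fx≡fa _ | inj₂ (fb≡fx , βfb) =
    contradiction (inj₂ (sym fx≡fa , subst (λ l → β l ≡ true) (trans fb≡fx fx≡fa) βfb)) ¬Uax
  ... | tri> _ _ fa<fx | _                 = contradiction (inj₁ fa<fx) ¬Uax
  Uab≡false : U a b ≡ false
  Uab≡false = ¬-not λ Uab → case Equivalence.to (U⇔ a b) Uab of λ where
    (inj₁ fa<fb)      → Finₚ.<-asym fa<fb fb<fa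
    (inj₂ (fa≡fb , _)) → Finₚ.<-irrefl (sym fa≡fb) fb<fa

-- Equidistribution forces a weak order

total-zero : ∀ {r} → total {r} (λ _ → 0) ≡ 0
total-zero {zero}  = refl
total-zero {suc r} = total-zero {r}

total-cong : ∀ {r} {c c′ : Fin r → ℕ} → (∀ i → c i ≡ c′ i) → total c ≡ total c′
total-cong {zero}  c≗c′ = refl
total-cong {suc r} c≗c′ = cong₂ _+_ (c≗c′ Fin.zero) (total-cong (c≗c′ ∘ Fin.suc))

total-+ : ∀ {r} (c c′ : Fin r → ℕ) → total (λ i → c i + c′ i) ≡ total c + total c′
total-+ {zero}  c c′ = refl
total-+ {suc r} c c′ = trans (cong (c Fin.zero + c′ Fin.zero +_) (total-+ (c ∘ Fin.suc) (c′ ∘ Fin.suc)))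
                             (shuffle (c Fin.zero) (c′ Fin.zero) (total (c ∘ Fin.suc)) (total (c′ ∘ Fin.suc)))
  where
  shuffle : ∀ a b c d → a + b + (c + d) ≡ a + c + (b + d)
  shuffle = solve-∀

occ-++ : ∀ {r} (i : Fin r) u w → occ i (u ++ w) ≡ occ i u + occ i w
occ-++ i u w = trans (cong length (filter-++ (Fin._≟ i) u w)) (length-++ (filter (Fin._≟ i) u))

total-occ-[_] : ∀ {r} (a : Fin r) → total (λ i → occ i [ a ]) ≡ 1
total-occ-[_] {suc r} Fin.zero    = cong suc (total-zero {r})
total-occ-[_] {suc r} (Fin.suc a) = trans (total-cong occ-suc) (total-occ-[_] {r} a)
  where
  occ-suc : ∀ i → occ (Fin.suc i) [ Fin.suc a ] ≡ occ i [ a ]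
  occ-suc i with a Fin.≟ i
  ... | yes _ = refl
  ... | no  _ = refl

total-occ : ∀ {r} (w : List (Fin r)) → total (λ i → occ i w) ≡ length w
total-occ {r} []    = total-zero {r}
total-occ (a ∷ w) = begin
  total (λ i → occ i (a ∷ w))                 ≡⟨ total-cong (λ i → occ-++ i [ a ] w) ⟩
  total (λ i → occ i [ a ] + occ i w)         ≡⟨ total-+ (λ i → occ i [ a ]) (λ i → occ i w) ⟩
  total (λ i → occ i [ a ]) + total (λ i → occ i w) ≡⟨ cong₂ _+_ total-occ-[ a ] (total-occ w) ⟩
  suc (length w)                              ∎

module _ {r : ℕ} {U : Relation r} (E : Equidistributed U) where

  maj′≡⇒inv′≡ : ∀ k w → (∀ v → length v ≡ length w → inv′ U v ≡ k → maj′ U v ≡ k) →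
                maj′ U w ≡ k → inv′ U w ≡ k
  maj′≡⇒inv′≡ k w inv⇒maj maj≡k = proj₂ (proj₂ (∈-filter⁻ inv? {xs = words} w∈invs))
    where
    c : Fin r → ℕ
    c i = occ i w
    words = allWords r (total c)
    Rearrangement : List (Fin r) → Set
    Rearrangement v = ∀ i → occ i v ≡ c i
    maj? : Decidable (λ v → Rearrangement v × maj′ U v ≡ k)
    inv? : Decidable (λ v → Rearrangement v × inv′ U v ≡ k)
    maj? v = all? (λ i → occ i v ℕ.≟ c i) ×-dec (maj′ U v ℕ.≟ k)
    inv? v = all? (λ i → occ i v ℕ.≟ c i) ×-dec (inv′ U v ℕ.≟ k)
    length-≡ : ∀ {v} → Rearrangement v → length v ≡ length w
    length-≡ {v} occ≡ = trans (sym (total-occ v)) (trans (total-cong occ≡) (total-occ w))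
    invs⊆majs : filter inv? words ⊆ filter maj? words
    invs⊆majs = Sublist.filter⁺ inv? maj? inv⇒maj′ (⊆-refl {x = words})
      where
      inv⇒maj′ : ∀ {v v′} → v ≡ v′ → Rearrangement v × inv′ U v ≡ k → Rearrangement v′ × maj′ U v′ ≡ k
      inv⇒maj′ {v} refl (occ≡ , inv≡k) = occ≡ , inv⇒maj v (length-≡ {v} occ≡) inv≡k
    invs≡majs : filter inv? words ≡ filter maj? words
    invs≡majs = ≋⇒≡ (Sublist.to-≋ (sym (E c k)) invs⊆majs)
    w∈words : w ∈ words
    w∈words = subst (λ n → w ∈ allWords r n) (sym (total-occ w)) (∈-allWords⁺ w)
    w∈invs : w ∈ filter inv? words
    w∈invs = subst (w ∈_) (sym invs≡majs) (∈-filter⁺ maj? w∈words ((λ _ → refl) , maj≡k))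

  inv′-3 : ∀ a b d → inv′ U (a ∷ b ∷ d ∷ []) ≡ χ (U a b) + χ (U a d) + χ (U b d)
  inv′-3 a b d = begin
    inv′ U (a ∷ b ∷ d ∷ [])                               ≡⟨ inv′-∷ U a (b ∷ d ∷ []) ⟩
    χ (U a b) + (χ (U a d) + 0) + inv′ U (b ∷ d ∷ [])
      ≡⟨ cong (χ (U a b) + (χ (U a d) + 0) +_) (inv′-∷ U b [ d ]) ⟩
    χ (U a b) + (χ (U a d) + 0) + (χ (U b d) + 0 + 0)
      ≡⟨ arith (χ (U a b)) (χ (U a d)) (χ (U b d)) ⟩
    χ (U a b) + χ (U a d) + χ (U b d)                     ∎
    where
    arith : ∀ p q s → p + (q + 0) + (s + 0 + 0) ≡ p + q + s
    arith = solve-∀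

  maj′-3 : ∀ a b d → maj′ U (a ∷ b ∷ d ∷ []) ≡ χ (U a b) + 2 * χ (U b d)
  maj′-3 a b d = cong₂ _+_ (+-identityʳ (χ (U a b))) (+-identityʳ (2 * χ (U b d)))

  inv′≡3⇒maj′≡3 : ∀ v → length v ≡ 3 → inv′ U v ≡ 3 → maj′ U v ≡ 3
  inv′≡3⇒maj′≡3 (a ∷ b ∷ d ∷ []) _ inv′≡3
    with U a b | U a d | U b d | trans (sym (inv′-3 a b d)) inv′≡3 | maj′-3 a b d
  ... | true  | _     | true  | _  | maj′≡ = maj′≡
  ... | true  | true  | false | () | _
  ... | true  | false | false | () | _
  ... | false | true  | true  | () | _
  ... | false | true  | false | () | _
  ... | false | false | true  | () | _
  ... | false | false | false | () | _

  inv′≡0⇒maj′≡0 : ∀ v → length v ≡ 3 → inv′ U v ≡ 0 → maj′ U v ≡ 0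
  inv′≡0⇒maj′≡0 (a ∷ b ∷ d ∷ []) _ inv′≡0
    with U a b | U a d | U b d | trans (sym (inv′-3 a b d)) inv′≡0 | maj′-3 a b d
  ... | false | _     | false | _  | maj′≡ = maj′≡
  ... | true  | true  | true  | () | _
  ... | true  | true  | false | () | _
  ... | true  | false | true  | () | _
  ... | true  | false | false | () | _
  ... | false | true  | true  | () | _
  ... | false | false | true  | () | _

  equidistributed⇒transitive : ∀ {x y z} → U x y ≡ true → U y z ≡ true → U x z ≡ true
  equidistributed⇒transitive {x} {y} {z} Uxy Uyz = ¬-not λ Uxz →
    case trans (sym (inv′≡2 Uxz)) (maj′≡⇒inv′≡ 3 (x ∷ y ∷ z ∷ []) inv′≡3⇒maj′≡3 maj′≡3) of λ ()
    where
    maj′≡3 : maj′ U (x ∷ y ∷ z ∷ []) ≡ 3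
    maj′≡3 = trans (maj′-3 x y z) (cong₂ (λ p q → χ p + 2 * χ q) Uxy Uyz)
    inv′≡2 : U x z ≡ false → inv′ U (x ∷ y ∷ z ∷ []) ≡ 2
    inv′≡2 Uxz = trans (inv′-3 x y z) (cong₂ _+_ (cong₂ _+_ (cong χ Uxy) (cong χ Uxz)) (cong χ Uyz))

  equidistributed⇒cotransitive : ∀ {x y z} → U x y ≡ false → U y z ≡ false → U x z ≡ false
  equidistributed⇒cotransitive {x} {y} {z} Uxy Uyz = ¬-not λ Uxz →
    case trans (sym (inv′≡1 Uxz)) (maj′≡⇒inv′≡ 0 (x ∷ y ∷ z ∷ []) inv′≡0⇒maj′≡0 maj′≡0) of λ ()
    where
    maj′≡0 : maj′ U (x ∷ y ∷ z ∷ []) ≡ 0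
    maj′≡0 = trans (maj′-3 x y z) (cong₂ (λ p q → χ p + 2 * χ q) Uxy Uyz)
    inv′≡1 : U x z ≡ true → inv′ U (x ∷ y ∷ z ∷ []) ≡ 1
    inv′≡1 Uxz = trans (inv′-3 x y z) (cong₂ _+_ (cong₂ _+_ (cong χ Uxy) (cong χ Uxz)) (cong χ Uyz))

-- Weak orders are bipartitional

module DenseRanking {r : ℕ} (g : Fin r → ℕ) where

  rank : ℕ → ℕ
  rank zero    = 0
  rank (suc t) with any? (λ y → g y ℕ.≟ t)
  ... | yes _ = suc (rank t)
  ... | no  _ = rank t

  rank-≤-suc : ∀ t → rank t ≤ rank (suc t)
  rank-≤-suc t with any? (λ y → g y ℕ.≟ t)
  ... | yes _ = n≤1+n (rank t)
  ... | no  _ = ≤-refl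

  rank-mono : ∀ {s t} → s ≤ t → rank s ≤ rank t
  rank-mono s≤t = go (≤⇒≤′ s≤t)
    where
    go : ∀ {s t} → s ℕ.≤′ t → rank s ≤ rank t
    go ℕ.≤′-refl        = ≤-refl
    go (ℕ.≤′-step s≤′t) = ≤-trans (go s≤′t) (rank-≤-suc _)

  rank-attained : ∀ x → rank (g x) < rank (suc (g x))
  rank-attained x with any? (λ y → g y ℕ.≟ g x)
  ... | yes _ = ≤-refl
  ... | no ¬∃ = contradiction (x , refl) ¬∃

  rank-< : ∀ {x t} → g x < t → rank (g x) < rank t
  rank-< {x} gx<t = <-≤-trans (rank-attained x) (rank-mono gx<t)

  rank-onto : ∀ t {l} → l < rank t → ∃ λ y → rank (g y) ≡ l
  rank-onto (suc t) {l} l<rank with any? (λ y → g y ℕ.≟ t)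
  ... | no  _ = rank-onto t l<rank
  ... | yes (y , gy≡t) with m≤n⇒m<n∨m≡n (≤-pred l<rank)
  ...   | inj₁ l<rank-t = rank-onto t l<rank-t
  ...   | inj₂ refl     = y , cong rank gy≡t

dense-ranking : ∀ {r} (g : Fin r → ℕ) B → (∀ x → g x < B) →
                ∃₂ λ m (F : Fin r → Fin m) → (∀ l → ∃ λ x → F x ≡ l) ×
                  (∀ {x y} → g x < g y → F x Fin.< F y) × (∀ {x y} → g x ≡ g y → F x ≡ F y)
dense-ranking g B g<B = rank B , F , F-surjective , F-< , F-≡
  where
  open DenseRanking g
  F : _ → Fin (rank B)
  F x = Fin.fromℕ< (rank-< (g<B x))
  toℕ-F : ∀ x → Fin.toℕ (F x) ≡ rank (g x)
  toℕ-F x = Finₚ.toℕ-fromℕ< (rank-< (g<B x))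
  F-surjective : ∀ l → ∃ λ x → F x ≡ l
  F-surjective l with y , rank≡ ← rank-onto B (Finₚ.toℕ<n l) = y , Finₚ.toℕ-injective (trans (toℕ-F y) rank≡)
  F-< : ∀ {x y} → g x < g y → F x Fin.< F y
  F-< {x} {y} gx<gy = subst₂ _<_ (sym (toℕ-F x)) (sym (toℕ-F y)) (rank-< gx<gy)
  F-≡ : ∀ {x y} → g x ≡ g y → F x ≡ F y
  F-≡ {x} {y} gx≡gy = Finₚ.toℕ-injective (trans (toℕ-F x) (trans (cong rank gx≡gy) (sym (toℕ-F y))))

module WeakOrder {r : ℕ} (U : Relation r)
  (U-trans   : ∀ {x y z} → U x y ≡ true  → U y z ≡ true  → U x z ≡ true)
  (U-cotrans : ∀ {x y z} → U x y ≡ false → U y z ≡ false → U x z ≡ false) where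

  _≺_ _∼_ : Fin r → Fin r → Set
  x ≺ y = U x y ≡ true × U y x ≡ false
  x ∼ y = U x y ≡ U y x

  _≺?_ : ∀ x y → Dec (x ≺ y)
  x ≺? y = (U x y Bool.≟ true) ×-dec (U y x Bool.≟ false)

  ≺-trans : ∀ {x y z} → x ≺ y → y ≺ z → x ≺ z
  ≺-trans (Uxy , Uyx) (Uyz , Uzy) = U-trans Uxy Uyz , U-cotrans Uzy Uyx

  ≺-irrefl : ∀ {x} → ¬ (x ≺ x)
  ≺-irrefl (Uxx , Uxx′) with () ← trans (sym Uxx) Uxx′

  ≺-respʳ-∼ : ∀ {x y z} → y ∼ z → x ≺ y → x ≺ z
  ≺-respʳ-∼ {x} {y} {z} y∼z (Uxy , Uyx) with U y z in Uyz
  ... | true  = U-trans Uxy Uyz , ¬-not λ Uzx → case trans (sym (U-trans Uyz Uzx)) Uyx of λ ()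
  ... | false = ¬-not (λ Uxz → case trans (sym (U-cotrans Uxz (sym y∼z))) Uxy of λ ()) ,
                U-cotrans (sym y∼z) Uyx

  ∼-diag : ∀ {x y} → x ∼ y → U x y ≡ U x x
  ∼-diag {x} {y} x∼y with U x y in Uxy
  ... | true  = sym (U-trans Uxy (sym x∼y))
  ... | false = sym (U-cotrans Uxy (sym x∼y))

  trichotomy : ∀ x y → x ≺ y ⊎ y ≺ x ⊎ x ∼ y
  trichotomy x y with U x y | U y x
  ... | true  | false = inj₁ (refl , refl)
  ... | false | true  = inj₂ (inj₁ (refl , refl))
  ... | true  | true  = inj₂ (inj₂ refl)
  ... | false | false = inj₂ (inj₂ refl)

  level : Fin r → ℕ
  level x = length (filter (_≺? x) (allFin r))

  level-< : ∀ {x y} → x ≺ y → level x < level y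
  level-< {x} {y} x≺y = ≤∧≢⇒< (Sublist.length-mono-≤ below-x⊆below-y) λ level≡ →
    ≺-irrefl (proj₂ (∈-filter⁻ (_≺? x) {xs = allFin r}
      (subst (x ∈_) (sym (≋⇒≡ (Sublist.to-≋ level≡ below-x⊆below-y)))
             (∈-filter⁺ (_≺? y) (∈-allFin x) x≺y))))
    where
    below-x⊆below-y : filter (_≺? x) (allFin r) ⊆ filter (_≺? y) (allFin r)
    below-x⊆below-y =
      Sublist.filter⁺ (_≺? x) (_≺? y) (λ { refl v≺x → ≺-trans v≺x x≺y }) (⊆-refl {x = allFin r})

  level-≡ : ∀ {x y} → x ∼ y → level x ≡ level y
  level-≡ {x} {y} x∼y =
    cong length (filter-≐ (_≺? x) (_≺? y) (≺-respʳ-∼ x∼y , ≺-respʳ-∼ (sym x∼y)) (allFin r))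

  level<1+r : ∀ x → level x < suc r
  level<1+r x = s≤s (≤-trans (length-filter (_≺? x) (allFin r)) (≤-reflexive (length-tabulate id)))

  bipartitional : Bipartitional U
  bipartitional with m , F , F-surjective , F-< , F-≡ ← dense-ranking level (suc r) level<1+r =
    m , F , β , F-surjective , λ x y → mk⇔ (to x y) (from x y)
    where
    F≡⇒∼ : ∀ {x y} → F x ≡ F y → x ∼ y
    F≡⇒∼ {x} {y} Fx≡Fy with trichotomy x y
    ... | inj₁ x≺y        = contradiction (F-< (level-< x≺y)) (Finₚ.<-irrefl Fx≡Fy)
    ... | inj₂ (inj₁ y≺x) = contradiction (F-< (level-< y≺x)) (Finₚ.<-irrefl (sym Fx≡Fy))
    ... | inj₂ (inj₂ x∼y) = x∼y
    β : Fin m → Bool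
    β l = let z = proj₁ (F-surjective l) in U z z
    β-F : ∀ x → β (F x) ≡ U x x
    β-F x = let z , Fz≡Fx = F-surjective (F x) ; z∼x = F≡⇒∼ Fz≡Fx in
      trans (sym (∼-diag z∼x)) (trans z∼x (∼-diag (sym z∼x)))
    to : ∀ x y → U x y ≡ true → F x Fin.< F y ⊎ (F x ≡ F y × β (F x) ≡ true)
    to x y Uxy with U y x in Uyx
    ... | false = inj₁ (F-< (level-< (Uxy , Uyx)))
    ... | true  = let x∼y = trans Uxy (sym Uyx) in
      inj₂ (F-≡ (level-≡ x∼y) , trans (β-F x) (trans (sym (∼-diag x∼y)) Uxy))
    from : ∀ x y → F x Fin.< F y ⊎ (F x ≡ F y × β (F x) ≡ true) → U x y ≡ true
    from x y (inj₂ (Fx≡Fy , βFx)) = trans (∼-diag (F≡⇒∼ Fx≡Fy)) (trans (sym (β-F x)) βFx)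
    from x y (inj₁ Fx<Fy) with trichotomy x y
    ... | inj₁ (Uxy , _)  = Uxy
    ... | inj₂ (inj₁ y≺x) = contradiction Fx<Fy (Finₚ.<-asym (F-< (level-< y≺x)))
    ... | inj₂ (inj₂ x∼y) = contradiction (F-≡ (level-≡ x∼y)) (Finₚ.<⇒≢ Fx<Fy)

theorem1 : (r : ℕ) → 1 ≤ r → (U : Relation r) → Equidistributed U ⇔ Bipartitional U
theorem1 r _ U = mk⇔
  (λ E → WeakOrder.bipartitional U (equidistributed⇒transitive E) (equidistributed⇒cotransitive E))
  (λ B → separated⇒equidistributed U (bipartitional⇒separated U B))
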